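{- Let $p\ge0$ and $q\ge1$ be fixed integers. The set of finite digraphs that contain at most $p$ vertices of loop-free degree at least $q$ is first-order definable in $(\mathcal{D};\sqsubseteq)$ with finitely many constants (finite digraphs) added.
   Context: Digraphs are pairs $(V,E)$, $V$ nonempty finite, $E\subseteq V^2$ (loops allowed); $\mathcal{D}$ is the set of their isomorphism types; $G\sqsubseteq G'$ means $G$ is isomorphic to an induced substructure of $G'$. The loop-free degree of a vertex is the total number of in-edges and out-edges at it, not counting loops. A set is definable if some first-order formula in the language of partial orders with the constants is satisfied exactly by its elements. -}

module Defs where

open import Data.Nat using (ℕ; zero; suc; _+_; _≤_; _≤?_)
open import Data.Fin using (Fin; zero; suc)
open import Data.Fin.Properties using (_≟_)
open import Data.Bool using (Bool; true; false; if_then_else_)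
open import Data.Product using (Σ; _×_; _,_; ∃)
open import Data.Sum using (_⊎_)
open import Data.Empty using (⊥)
open import Relation.Nullary using (¬_; does)
open import Relation.Binary.PropositionalEquality using (_≡_)
open import Function.Definitions using (Injective)
open import Function.Bundles using (_⇔_)

-- Finite digraphs: nonempty finite vertex set Fin (suc m), edge relation
-- E ⊆ V² given by a Boolean adjacency function (loops allowed).

record Digraph : Set where
  constructor digraph
  field
    pred  : ℕ
    edge  : Fin (suc pred) → Fin (suc pred) → Bool

open Digraph public

V : Digraph → Set
V G = Fin (suc (pred G))

-- G ⊑ H : G is isomorphic to an induced substructure of H
-- (an injective map of vertices preserving edges and non-edges).
_⊑_ : Digraph → Digraph → Set
G ⊑ H = Σ (V G → V H) λ f →
          Injective _≡_ _≡_ f × (∀ u v → edge G u v ≡ edge H (f u) (f v))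

_≅_ : Digraph → Digraph → Set
G ≅ H = Σ (V G → V H) λ f → Σ (V H → V G) λ g →
          (∀ x → g (f x) ≡ x) × (∀ y → f (g y) ≡ y) ×
          (∀ u v → edge G u v ≡ edge H (f u) (f v))

count : ∀ {n} → (Fin n → Bool) → ℕ
count {zero}  P = 0
count {suc n} P = (if P zero then 1 else 0) + count (λ i → P (suc i))

lfdeg : (G : Digraph) → V G → ℕ
lfdeg G v =
  count (λ u → if does (u ≟ v) then false else edge G v u) +
  count (λ u → if does (u ≟ v) then false else edge G u v)

highDeg : ℕ → Digraph → ℕ
highDeg q G = count (λ v → does (q ≤? lfdeg G v))

-- First-order logic in the language of partial orders {≤} (with
-- equality) extended by k constant symbols.  Variables are de Bruijn
-- indices: Formula k n has n free variables.

data Term (k n : ℕ) : Set where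
  var : Fin n → Term k n
  con : Fin k → Term k n

data Formula (k : ℕ) : ℕ → Set where
  _≤ᶠ_ : ∀ {n} → Term k n → Term k n → Formula k n
  _≐_  : ∀ {n} → Term k n → Term k n → Formula k n
  ⊥ᶠ   : ∀ {n} → Formula k n
  ¬ᶠ_  : ∀ {n} → Formula k n → Formula k n
  _∧ᶠ_ : ∀ {n} → Formula k n → Formula k n → Formula k n
  _∨ᶠ_ : ∀ {n} → Formula k n → Formula k n → Formula k n
  _⇒ᶠ_ : ∀ {n} → Formula k n → Formula k n → Formula k n
  ∀ᶠ   : ∀ {n} → Formula k (suc n) → Formula k n
  ∃ᶠ   : ∀ {n} → Formula k (suc n) → Formula k n

-- Semantics in (𝒟; ⊑) with constants c : Fin k → Digraph.
-- Elements of 𝒟 are represented by digraphs; equality of 𝒟 is ≅.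
Env : ℕ → Set
Env n = Fin n → Digraph

extend : ∀ {n} → Digraph → Env n → Env (suc n)
extend G ρ zero    = G
extend G ρ (suc i) = ρ i

⟦_⟧ₜ : ∀ {k n} → Term k n → (Fin k → Digraph) → Env n → Digraph
⟦ var i ⟧ₜ c ρ = ρ i
⟦ con j ⟧ₜ c ρ = c j

Sat : ∀ {k n} → (Fin k → Digraph) → Env n → Formula k n → Set
Sat c ρ (s ≤ᶠ t) = ⟦ s ⟧ₜ c ρ ⊑ ⟦ t ⟧ₜ c ρ
Sat c ρ (s ≐ t)  = ⟦ s ⟧ₜ c ρ ≅ ⟦ t ⟧ₜ c ρ
Sat c ρ ⊥ᶠ       = ⊥
Sat c ρ (¬ᶠ φ)   = ¬ Sat c ρ φ
Sat c ρ (φ ∧ᶠ ψ) = Sat c ρ φ × Sat c ρ ψ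
Sat c ρ (φ ∨ᶠ ψ) = Sat c ρ φ ⊎ Sat c ρ ψ
Sat c ρ (φ ⇒ᶠ ψ) = Sat c ρ φ → Sat c ρ ψ
Sat c ρ (∀ᶠ φ)   = (G : Digraph) → Sat c (extend G ρ) φ
Sat c ρ (∃ᶠ φ)   = Σ Digraph λ G → Sat c (extend G ρ) φ

Definable : (Digraph → Set) → Set
Definable P = Σ ℕ λ k → Σ (Fin k → Digraph) λ c → Σ (Formula k 1) λ φ →
  ∀ G → (Sat c (λ _ → G) φ ⇔ P G)

-- Call a digraph dense when more than p of its vertices have loop-free
-- degree at least q.  Density is inherited upwards along ⊑: an embedding
-- can only raise loop-free degrees, and it maps vertices injectively.
-- Conversely every dense G has a dense induced subdigraph on at most
-- N = (p+1)(2q+1) vertices: keep p+1 vertices of high degree, and for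
-- each of them its first q out-neighbours and first q in-neighbours (all
-- of them if there are fewer).  Hence G is sparse iff no dense digraph
-- with at most N vertices embeds into G.  There are finitely many such
-- digraphs up to mutual embeddability; taking an enumeration c of them as
-- constants, the formula ¬ ⋁ᵢ (cᵢ ≤ x) defines the sparse digraphs.

module Submission where

open import Defs
open import Data.Nat using (ℕ; zero; suc; _+_; _*_; _≤_; _≤?_; _⊓_; z≤n; s≤s)
open import Data.Nat.Properties
  using (module ≤-Reasoning; +-commutativeSemigroup; ≤-refl; ≤-reflexive; ≤-trans; ≤-total;
         +-mono-≤; *-monoˡ-≤; m≤m+n; m≤n+m; m⊓n≤m; m⊓n≤n; m≤n⇒m⊓n≡m; m≥n⇒m⊓n≡n; <⇒≱; ≰⇒>)
open import Algebra.Properties.CommutativeSemigroup +-commutativeSemigroup using (x∙yz≈y∙xz)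
open import Data.Fin using (Fin; zero; suc; punchIn; punchOut)
open import Data.Fin.Properties
  using (_≟_; ¬Fin0; 0≢1+n; suc-injective; punchIn-punchOut; punchOut-injective)
import Data.Vec.Functional as Vector
open import Data.Bool using (Bool; true; false; if_then_else_)
import Data.Bool.Properties as Bool
open import Data.Product using (Σ; ∃; _×_; _,_; proj₁; proj₂)
open import Data.Sum using (inj₁; inj₂)
open import Data.List
  using (List; []; _∷_; length; lookup; take; filter; _++_; map; concatMap;
         deduplicate; allFin; tabulate; upTo)
open import Data.List.Properties using (length-take; length-++; length-deduplicate)
open import Data.List.Relation.Unary.All as All using ()
open import Data.List.Relation.Unary.AllPairs using (_∷_)
open import Data.List.Relation.Unary.Any as Any using (Any; here; there)
open import Data.List.Relation.Unary.Any.Properties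
  using (lookup-index; lookup-result; map⁺; concatMap⁺; filter⁺)
open import Data.List.Relation.Unary.Unique.Propositional using (Unique)
import Data.List.Relation.Unary.Unique.DecPropositional.Properties as Unique
open import Data.List.Membership.Propositional using (_∈_)
open import Data.List.Membership.Propositional.Properties
  using (∈-lookup; ∈-filter⁻; ∈-++⁺ˡ; ∈-++⁺ʳ; ∈-concatMap⁺; ∈-deduplicate⁺; ∈-upTo⁺)
open import Data.List.Relation.Binary.Subset.Propositional using (_⊆_)
import Data.List.Relation.Binary.Sublist.Propositional as Sublist
import Data.List.Relation.Binary.Sublist.Propositional.Properties as Sublist
open import Function using (_∘_; id; flip)
open import Function.Bundles using (_⇔_; mk⇔; Equivalence)
open import Function.Definitions using (Injective)
open import Relation.Nullary using (¬_; Dec; yes; no; does; contradiction)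
open import Relation.Nullary.Decidable using (dec-true)
open import Relation.Binary.PropositionalEquality
  using (_≡_; _≢_; refl; sym; trans; cong; cong₂; subst)

open ≤-Reasoning

dec-true⁻ : ∀ {A : Set} (a? : Dec A) → does a? ≡ true → A
dec-true⁻ (yes a) _  = a
dec-true⁻ (no _)  ()

⊓-subadditive : ∀ q a b → q ⊓ (a + b) ≤ q ⊓ a + q ⊓ b
⊓-subadditive q a b with ≤-total q a | ≤-total q b
... | inj₁ q≤a | _ = begin
  q ⊓ (a + b)       ≤⟨ m⊓n≤m q _ ⟩
  q                 ≡⟨ m≤n⇒m⊓n≡m q≤a ⟨
  q ⊓ a             ≤⟨ m≤m+n _ _ ⟩
  q ⊓ a + q ⊓ b     ∎
... | inj₂ _ | inj₁ q≤b = begin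
  q ⊓ (a + b)       ≤⟨ m⊓n≤m q _ ⟩
  q                 ≡⟨ m≤n⇒m⊓n≡m q≤b ⟨
  q ⊓ b             ≤⟨ m≤n+m _ _ ⟩
  q ⊓ a + q ⊓ b     ∎
... | inj₂ a≤q | inj₂ b≤q = begin
  q ⊓ (a + b)       ≤⟨ m⊓n≤n q _ ⟩
  a + b             ≡⟨ cong₂ _+_ (m≥n⇒m⊓n≡n a≤q) (m≥n⇒m⊓n≡n b≤q) ⟨
  q ⊓ a + q ⊓ b     ∎

ind : Bool → ℕ
ind b = if b then 1 else 0

ind-mono : ∀ {a b} → (a ≡ true → b ≡ true) → ind a ≤ ind b
ind-mono {false} _   = z≤n
ind-mono {true}  a⇒b rewrite a⇒b refl = ≤-refl

count-cong : ∀ {n} {P Q : Fin n → Bool} → (∀ i → P i ≡ Q i) → count P ≡ count Q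
count-cong {zero}  _   = refl
count-cong {suc n} P≗Q = cong₂ _+_ (cong ind (P≗Q zero)) (count-cong (P≗Q ∘ suc))

count-true : ∀ n → count {n} (λ _ → true) ≡ n
count-true zero    = refl
count-true (suc n) = cong suc (count-true n)

count-punchIn : ∀ {n} (Q : Fin (suc n) → Bool) i →
                count Q ≡ ind (Q i) + count (Q ∘ punchIn i)
count-punchIn Q zero = refl
count-punchIn {suc n} Q (suc i) =
  trans (cong (ind (Q zero) +_) (count-punchIn (Q ∘ suc) i))
        (x∙yz≈y∙xz (ind (Q zero)) (ind (Q (suc i))) (count (Q ∘ suc ∘ punchIn i)))

count-≤-injection : ∀ {a b} (f : Fin a → Fin b) → Injective _≡_ _≡_ f →
                    {P : Fin a → Bool} {Q : Fin b → Bool} →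
                    (∀ x → P x ≡ true → Q (f x) ≡ true) → count P ≤ count Q
count-≤-injection {zero}          _ _     _ = z≤n
count-≤-injection {suc a} {zero}  f _     _ = contradiction (f zero) ¬Fin0
count-≤-injection {suc a} {suc b} f f-inj {P} {Q} P⇒Q = begin
  ind (P zero) + count (P ∘ suc)
    ≤⟨ +-mono-≤ (ind-mono (P⇒Q zero)) (count-≤-injection g g-inj P⇒Q∘g) ⟩
  ind (Q (f zero)) + count (Q ∘ punchIn (f zero))
    ≡⟨ count-punchIn Q (f zero) ⟨
  count Q ∎
  where
  -- the remaining points are sent to Fin b by deleting the image of zero
  f₀≢ : ∀ x → f zero ≢ f (suc x)
  f₀≢ x eq = 0≢1+n (f-inj eq)
  g : Fin a → Fin b
  g x = punchOut (f₀≢ x)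
  g-inj : Injective _≡_ _≡_ g
  g-inj {x} {y} eq = suc-injective (f-inj (punchOut-injective (f₀≢ x) (f₀≢ y) eq))
  P⇒Q∘g : ∀ x → P (suc x) ≡ true → Q (punchIn (f zero) (g x)) ≡ true
  P⇒Q∘g x Px = subst (λ z → Q z ≡ true) (sym (punchIn-punchOut (f₀≢ x))) (P⇒Q (suc x) Px)

count-∘-injective : ∀ {a b} (f : Fin a → Fin b) → Injective _≡_ _≡_ f →
                    (Q : Fin b → Bool) → count (Q ∘ f) ≤ count Q
count-∘-injective f f-inj Q = count-≤-injection f f-inj (λ _ Qfx → Qfx)

lookup-injective : ∀ {A : Set} {xs : List A} → Unique xs → Injective _≡_ _≡_ (lookup xs)
lookup-injective (_  ∷ _) {zero}  {zero}  _  = refl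
lookup-injective (x∉ ∷ _) {zero}  {suc j} eq = contradiction eq (All.lookup x∉ (∈-lookup j))
lookup-injective (x∉ ∷ _) {suc i} {zero}  eq = contradiction (sym eq) (All.lookup x∉ (∈-lookup i))
lookup-injective (_  ∷ u) {suc i} {suc j} eq = cong suc (lookup-injective u eq)

length-≤-count : ∀ {A : Set} {As xs : List A} → Unique As → As ⊆ xs →
                 (Q : Fin (length xs) → Bool) → (∀ i → lookup xs i ∈ As → Q i ≡ true) →
                 length As ≤ count Q
length-≤-count {As = As} {xs} As! As⊆xs Q Q-on-As = begin
  length As             ≡⟨ count-true (length As) ⟨
  count {length As} (λ _ → true)
                        ≤⟨ count-≤-injection pos pos-inj {P = λ _ → true}
                             (λ j _ → Q-on-As (pos j) (pos-∈ j)) ⟩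
  count Q               ∎
  where
  pos : Fin (length As) → Fin (length xs)
  pos j = Any.index (As⊆xs (∈-lookup j))
  pos-entry : ∀ j → lookup xs (pos j) ≡ lookup As j
  pos-entry j = sym (lookup-index (As⊆xs (∈-lookup j)))
  pos-∈ : ∀ j → lookup xs (pos j) ∈ As
  pos-∈ j = subst (_∈ As) (sym (pos-entry j)) (∈-lookup j)
  pos-inj : Injective _≡_ _≡_ pos
  pos-inj {j} {k} eq = lookup-injective As!
    (trans (sym (pos-entry j)) (trans (cong (lookup xs) eq) (pos-entry k)))

length-concatMap-≤ : ∀ {A B : Set} (f : A → List B) {bound} →
                     (∀ x → length (f x) ≤ bound) →
                     ∀ xs → length (concatMap f xs) ≤ length xs * bound
length-concatMap-≤ f bounded []       = z≤n
length-concatMap-≤ f bounded (x ∷ xs) = begin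
  length (f x ++ concatMap f xs)          ≡⟨ length-++ (f x) ⟩
  length (f x) + length (concatMap f xs)
    ≤⟨ +-mono-≤ (bounded x) (length-concatMap-≤ f bounded xs) ⟩
  length (x ∷ xs) * _                     ∎

length-filter-tabulate : ∀ {A : Set} {n} (f : Fin n → A) (b : A → Bool) →
  length (filter (λ x → b x Bool.≟ true) (tabulate f)) ≡ count (b ∘ f)
length-filter-tabulate {n = zero}  f b = refl
length-filter-tabulate {n = suc n} f b with b (f zero)
... | true  = cong suc (length-filter-tabulate (f ∘ suc) b)
... | false = length-filter-tabulate (f ∘ suc) b

select : ∀ {n} → (Fin n → Bool) → ℕ → List (Fin n)
select b k = take k (filter (λ i → b i Bool.≟ true) (allFin _))

module _ {n} (b : Fin n → Bool) (k : ℕ) where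

  select-unique : Unique (select b k)
  select-unique = Unique.take⁺ k (Unique.filter⁺ _ (Unique.allFin⁺ n))

  select-sound : ∀ {i} → i ∈ select b k → b i ≡ true
  select-sound i∈ = proj₂ (∈-filter⁻ selected? {xs = allFin n} (Sublist.lookup taken i∈))
    where
    selected? = λ i → b i Bool.≟ true
    taken = Sublist.take-⊆ k (filter selected? (allFin n))

  select-length : length (select b k) ≡ k ⊓ count b
  select-length = trans (length-take k _) (cong (k ⊓_) (length-filter-tabulate id b))

nbr : ∀ {n} → (Fin n → Fin n → Bool) → Fin n → Fin n → Bool
nbr r x u = if does (u ≟ x) then false else r x u

Out In : (G : Digraph) → V G → V G → Bool
Out G = nbr (edge G)
In  G = nbr (flip (edge G))

nbr-transport : ∀ {m n} {r : Fin m → Fin m → Bool} {s : Fin n → Fin n → Bool}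
                {f : Fin m → Fin n} → Injective _≡_ _≡_ f →
                (∀ x u → r x u ≡ s (f x) (f u)) → ∀ x u → nbr r x u ≡ nbr s (f x) (f u)
nbr-transport {f = f} f-inj r≡s x u with u ≟ x | f u ≟ f x
... | yes _   | yes _     = refl
... | yes u≡x | no fu≢fx  = contradiction (cong f u≡x) fu≢fx
... | no u≢x  | yes fu≡fx = contradiction (f-inj fu≡fx) u≢x
... | no _    | no _      = r≡s x u

⊑-trans : ∀ {A B C} → A ⊑ B → B ⊑ C → A ⊑ C
⊑-trans (f , f-inj , f-edges) (g , g-inj , g-edges) =
  g ∘ f , f-inj ∘ g-inj , λ u v → trans (f-edges u v) (g-edges (f u) (f v))

module Embedding {H G : Digraph} (H⊑G : H ⊑ G) where
  private
    f = proj₁ H⊑G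
    f-inj = proj₁ (proj₂ H⊑G)
    f-edges = proj₂ (proj₂ H⊑G)

  lfdeg-⊑ : ∀ v → lfdeg H v ≡
            count (λ u → Out G (f v) (f u)) + count (λ u → In G (f v) (f u))
  lfdeg-⊑ v =
    cong₂ _+_ (count-cong (nbr-transport {r = edge H} {s = edge G} f-inj f-edges v))
              (count-cong (nbr-transport {r = flip (edge H)} {s = flip (edge G)}
                                         f-inj (flip f-edges) v))

  lfdeg-mono : ∀ v → lfdeg H v ≤ lfdeg G (f v)
  lfdeg-mono v = begin
    lfdeg H v                                                          ≡⟨ lfdeg-⊑ v ⟩
    count (λ u → Out G (f v) (f u)) + count (λ u → In G (f v) (f u))
      ≤⟨ +-mono-≤ (count-∘-injective f f-inj (Out G (f v)))
                  (count-∘-injective f f-inj (In G (f v))) ⟩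
    lfdeg G (f v)                                                      ∎

  highDeg-mono : ∀ q → highDeg q H ≤ highDeg q G
  highDeg-mono q =
    count-≤-injection f f-inj {λ v → does (q ≤? lfdeg H v)} {λ w → does (q ≤? lfdeg G w)}
      λ v high → dec-true (q ≤? _) (≤-trans (dec-true⁻ (q ≤? _) high) (lfdeg-mono v))

induced : (G : Digraph) → V G → List (V G) → Digraph
induced G y ys = digraph (length ys) (λ i j → edge G (lookup (y ∷ ys) i) (lookup (y ∷ ys) j))

induced-⊑ : ∀ {G y ys} → Unique (y ∷ ys) → induced G y ys ⊑ G
induced-⊑ {y = y} {ys} y∷ys! = lookup (y ∷ ys) , lookup-injective y∷ys! , λ _ _ → refl

induced-degree : ∀ {G y ys} q (y∷ys! : Unique (y ∷ ys)) i →
                 select (Out G (lookup (y ∷ ys) i)) q ⊆ y ∷ ys →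
                 select (In G (lookup (y ∷ ys) i)) q ⊆ y ∷ ys →
                 q ⊓ lfdeg G (lookup (y ∷ ys) i) ≤ lfdeg (induced G y ys) i
induced-degree {G} {y} {ys} q y∷ys! i outs⊆ ins⊆ = begin
  q ⊓ (count (Out G x) + count (In G x))
    ≤⟨ ⊓-subadditive q _ _ ⟩
  q ⊓ count (Out G x) + q ⊓ count (In G x)
    ≡⟨ cong₂ _+_ (select-length (Out G x) q) (select-length (In G x) q) ⟨
  length (select (Out G x) q) + length (select (In G x) q)
    ≤⟨ +-mono-≤ (kept (Out G x) outs⊆) (kept (In G x) ins⊆) ⟩
  count (λ j → Out G x (lookup xs j)) + count (λ j → In G x (lookup xs j))
    ≡⟨ Embedding.lfdeg-⊑ {induced G y ys} {G} (induced-⊑ {G} {y} {ys} y∷ys!) i ⟨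
  lfdeg (induced G y ys) i ∎
  where
  xs = y ∷ ys
  x = lookup xs i
  kept : (b : V G → Bool) → select b q ⊆ xs → length (select b q) ≤ count (λ j → b (lookup xs j))
  kept b sel⊆ = length-≤-count (select-unique b q) sel⊆ _ (λ _ → select-sound b q)

witnessSize : ℕ → ℕ → ℕ
witnessSize p q = suc p * suc (q + q)

module SmallWitness (G : Digraph) (p q : ℕ) where

  high : V G → Bool
  high v = does (q ≤? lfdeg G v)

  W : List (V G)
  W = select high (suc p)

  star : V G → List (V G)
  star x = x ∷ select (Out G x) q ++ select (In G x) q

  covering-dense : ∀ y ys → Unique (y ∷ ys) → (∀ {w} → w ∈ W → star w ⊆ y ∷ ys) →
                   length W ≤ highDeg q (induced G y ys)
  covering-dense y ys y∷ys! covers =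
    length-≤-count (select-unique high (suc p)) (λ w∈W → covers w∈W (here refl)) _ stays-high
    where
    stays-high : ∀ i → lookup (y ∷ ys) i ∈ W → does (q ≤? lfdeg (induced G y ys) i) ≡ true
    stays-high i x∈W = dec-true (q ≤? _) (begin
      q
        ≡⟨ m≤n⇒m⊓n≡m (dec-true⁻ (q ≤? _) (select-sound high (suc p) x∈W)) ⟨
      q ⊓ lfdeg G (lookup (y ∷ ys) i)
        ≤⟨ induced-degree {G} {y} {ys} q y∷ys! i (covers x∈W ∘ there ∘ ∈-++⁺ˡ)
                                                 (covers x∈W ∘ there ∘ ∈-++⁺ʳ _) ⟩
      lfdeg (induced G y ys) i ∎)

  support : List (V G)
  support = deduplicate _≟_ (concatMap star W)

  support-covers : ∀ {w} → w ∈ W → star w ⊆ support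
  support-covers w∈W u∈star =
    ∈-deduplicate⁺ _≟_ (∈-concatMap⁺ star (Any.map (λ { refl → u∈star }) w∈W))

  length-star : ∀ x → length (star x) ≤ suc (q + q)
  length-star x = begin
    suc (length (select (Out G x) q ++ select (In G x) q))
      ≡⟨ cong suc (length-++ (select (Out G x) q)) ⟩
    suc (length (select (Out G x) q) + length (select (In G x) q))
      ≡⟨ cong suc (cong₂ _+_ (select-length (Out G x) q) (select-length (In G x) q)) ⟩
    suc (q ⊓ _ + q ⊓ _)
      ≤⟨ s≤s (+-mono-≤ (m⊓n≤m q (count (Out G x))) (m⊓n≤m q (count (In G x)))) ⟩
    suc (q + q) ∎

  length-support : length support ≤ witnessSize p q
  length-support = begin
    length support                      ≤⟨ length-deduplicate _≟_ (concatMap star W) ⟩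
    length (concatMap star W)           ≤⟨ length-concatMap-≤ star length-star W ⟩
    length W * suc (q + q)              ≤⟨ *-monoˡ-≤ _ |W|≤ ⟩
    witnessSize p q                     ∎
    where
    |W|≤ = ≤-trans (≤-reflexive (select-length high (suc p))) (m⊓n≤m _ _)

  Witness : Set
  Witness = Σ Digraph λ H → suc (pred H) ≤ witnessSize p q × suc p ≤ highDeg q H × H ⊑ G

  witness-on : (xs : List (V G)) → Unique xs → (∀ {w} → w ∈ W → star w ⊆ xs) →
               length xs ≤ witnessSize p q → length W ≡ suc p → Witness
  witness-on [] _ covers _ |W| =
    contradiction (covers (∈-lookup (subst Fin (sym |W|) zero)) (here refl)) λ ()
  witness-on (y ∷ ys) y∷ys! covers small |W| =
    induced G y ys , small ,
    subst (_≤ highDeg q (induced G y ys)) |W| (covering-dense y ys y∷ys! covers) ,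
    induced-⊑ {G} {y} {ys} y∷ys!

  small-witness : suc p ≤ highDeg q G → Witness
  small-witness dense =
    witness-on support (Unique.deduplicate-! _≟_ _) support-covers length-support
      (trans (select-length high (suc p)) (m≤n⇒m⊓n≡m dense))

functions : ∀ {A : Set} → List A → (k : ℕ) → List (Fin k → A)
functions xs zero    = Vector.[] ∷ []
functions xs (suc k) = concatMap (λ a → map (a Vector.∷_) (functions xs k)) xs

functions-complete : ∀ {A : Set} (R : A → A → Set) {xs : List A} → (∀ a → Any (R a) xs) →
                     ∀ {k} (f : Fin k → A) → Any (λ g → ∀ i → R (f i) (g i)) (functions xs k)
functions-complete R meets {zero}  f = here λ ()
functions-complete R {xs} meets {suc k} f =
  concatMap⁺ (λ a → map (a Vector.∷_) (functions xs k))
    (Any.map (λ Rf₀a → map⁺ (Any.map (pointwise Rf₀a) (functions-complete R meets (f ∘ suc))))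
             (meets (f zero)))
  where
  pointwise : ∀ {a g} → R (f zero) a → (∀ i → R (f (suc i)) (g i)) →
              ∀ i → R (f i) ((a Vector.∷ g) i)
  pointwise Rf₀a _    zero    = Rf₀a
  pointwise _    Rfg (suc i) = Rfg i

booleans : List Bool
booleans = true ∷ false ∷ []

booleans-complete : ∀ b → b ∈ booleans
booleans-complete true  = here refl
booleans-complete false = there (here refl)

smallDigraphs : ℕ → List Digraph
smallDigraphs N =
  concatMap (λ m → map (digraph m) (functions (functions booleans (suc m)) (suc m))) (upTo N)

same-edges-⊑ : ∀ {m} {e e′ : Fin (suc m) → Fin (suc m) → Bool} →
               (∀ u v → e u v ≡ e′ u v) → digraph m e ⊑ digraph m e′
same-edges-⊑ e≗e′ = id , id , e≗e′

smallDigraphs-complete : ∀ {N} H → suc (pred H) ≤ N →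
                         Any (λ H′ → H ⊑ H′ × H′ ⊑ H) (smallDigraphs N)
smallDigraphs-complete (digraph m e) m<N =
  concatMap⁺ (λ m → map (digraph m) (functions (functions booleans (suc m)) (suc m)))
    (Any.map (λ { refl → map⁺ (Any.map both-ways edges-listed) }) (∈-upTo⁺ m<N))
  where
  edges-listed = functions-complete (λ r r′ → ∀ v → r v ≡ r′ v)
                   (functions-complete _≡_ booleans-complete) e
  both-ways : ∀ {e′} → (∀ u v → e u v ≡ e′ u v) →
              digraph m e ⊑ digraph m e′ × digraph m e′ ⊑ digraph m e
  both-ways e≗e′ = same-edges-⊑ e≗e′ , same-edges-⊑ (λ u v → sym (e≗e′ u v))

⋁ : ∀ {k n m} → (Fin m → Formula k n) → Formula k n
⋁ {m = zero}  F = ⊥ᶠ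
⋁ {m = suc m} F = F zero ∨ᶠ ⋁ (F ∘ suc)

sat-⋁ : ∀ {k n m} (c : Fin k → Digraph) (ρ : Env n) (F : Fin m → Formula k n) →
        Sat c ρ (⋁ F) ⇔ ∃ λ i → Sat c ρ (F i)
sat-⋁ {m = zero}  c ρ F = mk⇔ (λ ()) (λ ())
sat-⋁ {m = suc m} c ρ F = mk⇔ to from
  where
  rest = sat-⋁ c ρ (F ∘ suc)
  to : Sat c ρ (⋁ F) → ∃ λ i → Sat c ρ (F i)
  to (inj₁ s) = zero , s
  to (inj₂ s) with Equivalence.to rest s
  ... | i , t = suc i , t
  from : (∃ λ i → Sat c ρ (F i)) → Sat c ρ (⋁ F)
  from (zero  , s) = inj₁ s
  from (suc i , s) = inj₂ (Equivalence.from rest (i , s))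

module Forbidden (p q : ℕ) where

  forbidden : List Digraph
  forbidden = filter (λ H → suc p ≤? highDeg q H) (smallDigraphs (witnessSize p q))

  forbidden-dense : ∀ i → suc p ≤ highDeg q (lookup forbidden i)
  forbidden-dense i = proj₂ (∈-filter⁻ (λ H → suc p ≤? highDeg q H) (∈-lookup {xs = forbidden} i))

  forbidden-complete : ∀ H → suc (pred H) ≤ witnessSize p q → suc p ≤ highDeg q H →
                       ∃ λ i → H ⊑ lookup forbidden i × lookup forbidden i ⊑ H
  forbidden-complete H small dense = pick (smallDigraphs-complete H small)
    where
    pick : Any (λ H′ → H ⊑ H′ × H′ ⊑ H) (smallDigraphs (witnessSize p q)) →
           ∃ λ i → H ⊑ lookup forbidden i × lookup forbidden i ⊑ H
    pick listed with filter⁺ (λ H → suc p ≤? highDeg q H) listed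
    ... | inj₁ listed-dense = Any.index listed-dense , lookup-index listed-dense
    ... | inj₂ not-dense    = contradiction
      (≤-trans dense
        (Embedding.highDeg-mono {H} {Any.lookup listed} (proj₁ (lookup-result listed)) q))
      not-dense

  sparse⇔forbidden-free : ∀ G → highDeg q G ≤ p ⇔ (¬ ∃ λ i → lookup forbidden i ⊑ G)
  sparse⇔forbidden-free G = mk⇔ to from
    where
    to : highDeg q G ≤ p → ¬ ∃ λ i → lookup forbidden i ⊑ G
    to sparse (i , cᵢ⊑G) =
      <⇒≱ (≤-trans (forbidden-dense i)
                   (Embedding.highDeg-mono {lookup forbidden i} {G} cᵢ⊑G q)) sparse
    from : (¬ ∃ λ i → lookup forbidden i ⊑ G) → highDeg q G ≤ p
    from free with highDeg q G ≤? p
    ... | yes sparse = sparse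
    ... | no ¬sparse with SmallWitness.small-witness G p q (≰⇒> ¬sparse)
    ... | H , small , dense , H⊑G with forbidden-complete H small dense
    ... | i , _ , cᵢ⊑H =
      contradiction (i , ⊑-trans {lookup forbidden i} {H} {G} cᵢ⊑H H⊑G) free

lemma17 : (p q : ℕ) → 1 ≤ q → Definable (λ G → highDeg q G ≤ p)
lemma17 p q _ = length forbidden , lookup forbidden , ¬ᶠ ⋁ embeds , λ G →
  let open Equivalence (sat-⋁ (lookup forbidden) (λ _ → G) embeds)
      open Equivalence (sparse⇔forbidden-free G) renaming (to to sparse⇒free; from to free⇒sparse)
  in mk⇔ (λ ¬sat → free⇒sparse (¬sat ∘ from)) (λ sparse → sparse⇒free sparse ∘ to)
  where
  open Forbidden p q
  embeds : Fin (length forbidden) → Formula (length forbidden) 1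
  embeds i = con i ≤ᶠ var zero
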